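{- Let $w\in S_\infty$, $\varphi$ a flag, $N$ a positive integer, and $r^{(\bullet)}\in\mathrm{RFC}(w,\varphi)$. Then $\hat P(\mathsf{shift}_N(r^{(\bullet)}))$ is obtained from $\hat P(r^{(\bullet)})$ by moving every box up $N$ rows and adding $N$ to every entry, and $\hat Q(\mathsf{shift}_N(r^{(\bullet)}))$ is obtained from $\hat Q(r^{(\bullet)})$ by moving every box up $N$ rows.
   Context: $s_i\in S_\infty$ swaps $i,i+1$; reduced words for $w$ are minimal-length words $i_1\cdots i_m$ with $w=s_{i_1}\cdots s_{i_m}$. An increasing factorization $\rho^{(\bullet)}=(\rho^{(k)}|\cdots|\rho^{(1)})$ of $\rho$ writes $\rho=\rho^{(k)}\cdots\rho^{(1)}$ with consecutive, possibly empty, strictly increasing subwords. A flag is a weakly increasing $\varphi:\mathbb{Z}_{>0}\to\mathbb{Z}_{>0}$ with $\varphi(m)\ge m$; $\rho^{(\bullet)}$ is $\varphi$-flagged if $\varphi(\rho^{(i)}_1)\ge i$ whenever $\rho^{(i)}$ is nonempty. $\mathrm{RFC}(w,\varphi)$ is the set of $\varphi$-flagged increasing factorizations of reduced words for $w$. For $w\in S_m$, $1_N\times w\in S_{N+m}$ fixes $1,\dots,N$ and maps $i+N\mapsto w(i)+N$; $\mathsf{shift}_N$ adds $N$ to every letter of every component, mapping factorizations for $w$ to factorizations for $1_N\times w$. Coxeter–Knuth equivalence $\sim$: transitive closure of $\mathbf a xyz\mathbf b\sim\mathbf a xzy\mathbf b$ ($y<x<z$), $\mathbf a xyz\mathbf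 b\sim\mathbf a yxz\mathbf b$ ($y<z<x$), $\mathbf a\, i(i+1)i\,\mathbf b\sim\mathbf a\,(i+1)i(i+1)\,\mathbf b$. Tableaux are fillings of finite sets of boxes (row $r\in\mathbb{Z}$, column $c\in\mathbb{Z}_{>0}$), rows left-justified, rows indexed upward. Weak descent tableau $\mathsf{WeakDesTab}(\rho)$: with run factorization (maximal strictly increasing runs) $(\sigma^{(k)}|\cdots|\sigma^{(1)})$, place $\sigma^{(k)}$ in row $\sigma^{(k)}_1$; for $i=k-1,\dots,1$ place $\sigma^{(i)}$ in row $\sigma^{(i)}_1$ if that is below the row of $\sigma^{(i+1)}$, else directly below it. Virtual: uses a non-positive row; else $\mathrm{des}(\rho)$ is its shape (row lengths). $\mu\le\nu$ iff $\sum_{i\le k}\mu_i\le\sum_{i\le k}\nu_i$ for all $k$; for non-virtual reduced words $\rho\le\tau$ iff $\rho\sim\tau$ and $\mathrm{des}(\rho)\le\mathrm{des}(\tau)$; each $\sim$-class has a unique non-virtual $\le$-minimal (Yamanouchi) element $\hat\rho$; $\hat P(\rho^{(\bullet)})=\hat P(\rho):=\mathsf{WeakDesTab}(\hat\rho)$. It is known that if $\sigma x$ is reduced, the diagram of $\hat P(\sigma x)$ is that of $\hat P(\sigma)$ plus one box. $\hat Q(\rho^{(\bullet)})$ is the filling of the diagram of $\hat P(\rho)$ in which a box has entry $i$ iff it lies in the diagram of $\hat P(\rho^{(k)}\cdots\rho^{(i)})$ but not in that of $\hat P(\rho^{(k)}\cdots\rho^{(i+1)})$. -}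

module Defs where

open import Data.Nat using (ℕ; zero; suc; _+_; _∸_; _≤_; _<_; _≡ᵇ_; _<ᵇ_)
open import Data.Integer as ℤ using (ℤ; +_)
open import Data.Bool using (Bool; true; false; if_then_else_)
open import Data.List using (List; []; _∷_; _++_; length; map; concat; take)
open import Data.List.Relation.Unary.All using (All)
open import Data.Maybe using (Maybe; just; nothing)
open import Data.Product using (Σ; _×_; _,_; proj₁)
open import Data.Unit using (⊤)
open import Relation.Nullary using (¬_)
open import Relation.Nullary.Decidable using (⌊_⌋)
open import Relation.Binary.PropositionalEquality using (_≡_)
open import Function.Bundles using (_⇔_)

Word : Set
Word = List ℕ

swapS : ℕ → ℕ → ℕ
swapS i x = if x ≡ᵇ i then suc i else (if x ≡ᵇ suc i then i else x)

perm : Word → ℕ → ℕ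
perm [] x = x
perm (i ∷ ρ) x = swapS i (perm ρ x)

Positive : Word → Set
Positive = All (λ i → 1 ≤ i)

ReducedWordFor : (ℕ → ℕ) → Word → Set
ReducedWordFor w ρ =
  Positive ρ × (∀ x → perm ρ x ≡ w x) ×
  (∀ σ → Positive σ → (∀ x → perm σ x ≡ w x) → length ρ ≤ length σ)

StrictInc : Word → Set
StrictInc [] = ⊤
StrictInc (x ∷ []) = ⊤
StrictInc (x ∷ y ∷ ys) = x < y × StrictInc (y ∷ ys)

IsFlag : (ℕ → ℕ) → Set
IsFlag φ = (∀ m n → 1 ≤ m → m ≤ n → φ m ≤ φ n) × (∀ m → 1 ≤ m → m ≤ φ m)

-- A factorization (ρ^(k) | ... | ρ^(1)) is the list ρ^(k) ∷ ... ∷ ρ^(1) ∷ [].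
Factorization : Set
Factorization = List Word

-- φ(ρ^(i)_1) ≥ i whenever ρ^(i) nonempty; the head component has index k = length
Flagged : (ℕ → ℕ) → Factorization → Set
Flagged φ [] = ⊤
Flagged φ ([] ∷ cs) = Flagged φ cs
Flagged φ ((x ∷ c) ∷ cs) = suc (length cs) ≤ φ x × Flagged φ cs

RFC : (ℕ → ℕ) → (ℕ → ℕ) → Factorization → Set
RFC w φ r = All StrictInc r × ReducedWordFor w (concat r) × Flagged φ r

shift : ℕ → Factorization → Factorization
shift N = map (map (λ x → N + x))

data CKstep : Word → Word → Set where
  ck1 : ∀ a b x y z → y < x → x < z →
        CKstep (a ++ x ∷ y ∷ z ∷ b) (a ++ x ∷ z ∷ y ∷ b)
  ck2 : ∀ a b x y z → y < z → z < x →
        CKstep (a ++ x ∷ y ∷ z ∷ b) (a ++ y ∷ x ∷ z ∷ b)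
  br  : ∀ a b i →
        CKstep (a ++ i ∷ suc i ∷ i ∷ b) (a ++ suc i ∷ i ∷ suc i ∷ b)

data _∼_ : Word → Word → Set where
  ∼refl  : ∀ {ρ} → ρ ∼ ρ
  ∼fwd   : ∀ {ρ σ τ} → CKstep ρ σ → σ ∼ τ → ρ ∼ τ
  ∼bwd   : ∀ {ρ σ τ} → CKstep σ ρ → σ ∼ τ → ρ ∼ τ

-- Tableaux: a box (row r ∈ ℤ, column c ≥ 1) is filled iff T r c ≡ just v.

Tableau : Set
Tableau = ℤ → ℕ → Maybe ℕ

InDiag : Tableau → ℤ → ℕ → Set
InDiag T r c = Σ ℕ (λ v → T r c ≡ just v)

-- maximal strictly increasing runs, left to right (σ^(k), ..., σ^(1))
runs : Word → List Word
runs [] = []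
runs (x ∷ xs) with runs xs
... | [] = (x ∷ []) ∷ []
... | [] ∷ rs = (x ∷ []) ∷ rs
... | (y ∷ r) ∷ rs = if x <ᵇ y then (x ∷ y ∷ r) ∷ rs else (x ∷ []) ∷ (y ∷ r) ∷ rs

hd : Word → ℕ
hd [] = 0
hd (x ∷ _) = x

placeAfter : ℤ → List Word → List (ℤ × Word)
placeAfter prev [] = []
placeAfter prev (σ ∷ σs) =
  let a = + hd σ
      row = if ⌊ a ℤ.<? prev ⌋ then a else prev ℤ.- + 1
  in (row , σ) ∷ placeAfter row σs

place : List Word → List (ℤ × Word)
place [] = []
place (σ ∷ σs) = (+ hd σ , σ) ∷ placeAfter (+ hd σ) σs

wdtRows : Word → List (ℤ × Word)
wdtRows ρ = place (runs ρ)

nth : Word → ℕ → Maybe ℕ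
nth [] _ = nothing
nth (x ∷ xs) zero = just x
nth (x ∷ xs) (suc n) = nth xs n

lookupRows : List (ℤ × Word) → ℤ → ℕ → Maybe ℕ
lookupRows [] r c = nothing
lookupRows ((r' , σ) ∷ ps) r zero = nothing
lookupRows ((r' , σ) ∷ ps) r (suc c) =
  if ⌊ r' ℤ.≟ r ⌋ then nth σ c else lookupRows ps r (suc c)

WeakDesTab : Word → Tableau
WeakDesTab ρ = lookupRows (wdtRows ρ)

NonVirtual : Word → Set
NonVirtual ρ = All (λ p → + 1 ℤ.≤ proj₁ p) (wdtRows ρ)

rowLen : List (ℤ × Word) → ℤ → ℕ
rowLen [] r = 0
rowLen ((r' , σ) ∷ ps) r = if ⌊ r' ℤ.≟ r ⌋ then length σ else rowLen ps r

des : Word → ℕ → ℕ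
des ρ i = rowLen (wdtRows ρ) (+ i)

psum : (ℕ → ℕ) → ℕ → ℕ
psum μ zero = 0
psum μ (suc k) = psum μ k + μ (suc k)

_⊴_ : (ℕ → ℕ) → (ℕ → ℕ) → Set
μ ⊴ ν = ∀ k → psum μ k ≤ psum ν k

_≼_ : Word → Word → Set
ρ ≼ τ = ρ ∼ τ × des ρ ⊴ des τ

IsYamanouchiOf : Word → Word → Set
IsYamanouchiOf ρ σ =
  σ ∼ ρ × NonVirtual σ ×
  (∀ τ → τ ∼ ρ → NonVirtual τ → τ ≼ σ → σ ≼ τ)

IsPhat : Word → Tableau → Set
IsPhat ρ T = Σ Word (λ σ → IsYamanouchiOf ρ σ × (∀ r c → T r c ≡ WeakDesTab σ r c))

-- Q is Q̂(r) for r = (ρ^(k) | ... | ρ^(1)).  Ts j is P̂ of the prefix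
-- ρ^(k) ⋯ ρ^(k-j+1) = concat (take j r); a box has entry i iff it lies
-- in Ts (k+1-i) but not in Ts (k-i).
IsQhat : Factorization → Tableau → Set
IsQhat rf Q =
  Σ (ℕ → Tableau) λ Ts →
    (∀ j → j ≤ length rf → IsPhat (concat (take j rf)) (Ts j)) ×
    (∀ r c → (InDiag Q r c ⇔ InDiag (Ts (length rf)) r c)) ×
    (∀ r c i → (Q r c ≡ just i) ⇔
       (1 ≤ i × i ≤ length rf ×
        InDiag (Ts (suc (length rf) ∸ i)) r c × ¬ InDiag (Ts (length rf ∸ i)) r c))

shiftP : ℕ → Tableau → Tableau
shiftP N T r c = Data.Maybe.map (λ x → N + x) (T (r ℤ.- + N) c)
  where import Data.Maybe

shiftQ : ℕ → Tableau → Tableau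
shiftQ N T r c = T (r ℤ.- + N) c

-- Adding N to every letter preserves the order of letters and commutes with
-- i ↦ i + 1, so it maps Coxeter–Knuth moves to Coxeter–Knuth moves; conversely,
-- moves never change the set of letters, so the class of a shifted word consists
-- of shifted words. Shifting preserves increasing runs, hence moves every row of
-- the weak descent tableau up N rows and gives the descent composition N leading
-- zeros. Among non-virtual words this leaves the dominance order unchanged, and a
-- word dominated by a shifted non-virtual word has empty rows 1, …, N, so it is
-- the shift of a non-virtual word. Hence the Yamanouchi word of the shifted class
-- is the shifted Yamanouchi word, and P̂ and every tableau entering Q̂ move up N rows.
module Submission where

open import Defs
open import Data.Nat using (ℕ; _≤_)
open import Data.List using (concat)
open import Data.Product using (_×_)

open import Data.Bool using (true; false; if_then_else_)
open import Data.Bool.Properties using (if-float)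
open import Data.Integer as ℤ using (ℤ; +_; +≤+; +<+)
import Data.Integer.Properties as ℤP
open import Algebra.Properties.AbelianGroup ℤP.+-0-abelianGroup using (//-rightDividesˡ; //-rightDividesʳ)
open import Algebra.Properties.CommutativeSemigroup ℤP.+-commutativeSemigroup using (xy∙z≈xz∙y)
open import Data.List using (List; []; _∷_; length; map; take)
import Data.List.Properties as List
open import Data.List.Membership.Propositional using (_∈_)
open import Data.List.Relation.Unary.All as All using (All; []; _∷_)
import Data.List.Relation.Unary.All.Properties as All
open import Data.List.Relation.Unary.Any using (here; there)
open import Data.Maybe as Maybe using (Maybe; just; nothing)
open import Data.Nat using (zero; suc; _+_; _∸_; _<_; _<ᵇ_; z≤n; s≤s; _≤?_)
import Data.Nat.Properties as ℕP
open import Data.Product using (Σ; _,_; proj₁; proj₂)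
open import Data.Sum using (inj₁; inj₂)
open import Data.Product.Function.NonDependent.Propositional using (_×-⇔_)
open import Data.Empty using (⊥)
open import Data.Unit using (⊤; tt)
open import Function using (_∘_)
open import Function.Bundles using (_⇔_; mk⇔; Equivalence)
import Function.Properties.Equivalence as ⇔
open import Function.Related.TypeIsomorphisms using (¬-cong-⇔)
open import Relation.Binary.PropositionalEquality
open import Relation.Nullary using (Dec; yes; no; contradiction)
open import Relation.Nullary.Decidable using (⌊_⌋; isYes≗does; does-⇔)

isYes-⇔ : ∀ {A B : Set} → A ⇔ B → (a? : Dec A) (b? : Dec B) → ⌊ a? ⌋ ≡ ⌊ b? ⌋
isYes-⇔ A⇔B a? b? = trans (isYes≗does a?) (trans (does-⇔ A⇔B a? b?) (sym (isYes≗does b?)))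

+-cancelʳ-<-⇔ : ∀ a p n → (a ℤ.+ n ℤ.< p ℤ.+ n) ⇔ (a ℤ.< p)
+-cancelʳ-<-⇔ a p n = mk⇔
  (λ lt → subst₂ ℤ._<_ (//-rightDividesʳ n a) (//-rightDividesʳ n p) (ℤP.+-monoˡ-< (ℤ.- n) lt))
  (ℤP.+-monoˡ-< n)

+≡⇔≡- : ∀ a r n → (a ℤ.+ n ≡ r) ⇔ (a ≡ r ℤ.- n)
+≡⇔≡- a r n = mk⇔
  (λ eq → trans (sym (//-rightDividesʳ n a)) (cong (ℤ._- n) eq))
  (λ eq → trans (cong (ℤ._+ n) eq) (//-rightDividesˡ n r))

+[m+n]≡+n++m : ∀ m n → + (m + n) ≡ + n ℤ.+ + m
+[m+n]≡+n++m m n = trans (ℤP.pos-+ m n) (ℤP.+-comm (+ m) (+ n))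

+[m+n]-+m≡+n : ∀ m n → + (m + n) ℤ.- + m ≡ + n
+[m+n]-+m≡+n m n = begin
  + (m + n) ℤ.- + m       ≡⟨ cong (ℤ._- + m) (+[m+n]≡+n++m m n) ⟩
  + n ℤ.+ + m ℤ.- + m     ≡⟨ //-rightDividesʳ (+ m) (+ n) ⟩
  + n                     ∎
  where open ≡-Reasoning

1≤r+N∧r≤0⇒r≡i-N : ∀ {r} N → + 1 ℤ.≤ r ℤ.+ + N → r ℤ.≤ + 0 →
                  Σ ℕ λ i → 1 ≤ i × i ≤ N × r ≡ + i ℤ.- + N
1≤r+N∧r≤0⇒r≡i-N {r} N 1≤r+N r≤0 with r ℤ.+ + N in r+N≡
1≤r+N∧r≤0⇒r≡i-N {r} N (+≤+ 1≤i) r≤0 | + i =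
  i , 1≤i , ℤP.drop‿+≤+ (subst (ℤ._≤ + N) r+N≡ (ℤP.+-monoˡ-≤ (+ N) r≤0)) ,
  Equivalence.to (+≡⇔≡- r (+ i) (+ N)) r+N≡

∼-trans : ∀ {ρ σ τ} → ρ ∼ σ → σ ∼ τ → ρ ∼ τ
∼-trans ∼refl q = q
∼-trans (∼fwd st p) q = ∼fwd st (∼-trans p q)
∼-trans (∼bwd st p) q = ∼bwd st (∼-trans p q)

∼-sym : ∀ {ρ σ} → ρ ∼ σ → σ ∼ ρ
∼-sym ∼refl = ∼refl
∼-sym (∼fwd st p) = ∼-trans (∼-sym p) (∼bwd st ∼refl)
∼-sym (∼bwd st p) = ∼-trans (∼-sym p) (∼fwd st ∼refl)

-- A move only rearranges letters, except the braid move, which still uses the same two letters.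
CKstep-All : ∀ {P : ℕ → Set} {ρ σ} → CKstep ρ σ → All P ρ → All P σ
CKstep-All (ck1 a b x y z _ _) h with All.++⁻ a h
... | pa , px ∷ py ∷ pz ∷ pb = All.++⁺ pa (px ∷ pz ∷ py ∷ pb)
CKstep-All (ck2 a b x y z _ _) h with All.++⁻ a h
... | pa , px ∷ py ∷ pz ∷ pb = All.++⁺ pa (py ∷ px ∷ pz ∷ pb)
CKstep-All (br a b i) h with All.++⁻ a h
... | pa , pi ∷ psi ∷ _ ∷ pb = All.++⁺ pa (psi ∷ pi ∷ psi ∷ pb)

CKstep-All⁻ : ∀ {P : ℕ → Set} {ρ σ} → CKstep ρ σ → All P σ → All P ρ
CKstep-All⁻ (ck1 a b x y z _ _) h with All.++⁻ a h
... | pa , px ∷ pz ∷ py ∷ pb = All.++⁺ pa (px ∷ py ∷ pz ∷ pb)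
CKstep-All⁻ (ck2 a b x y z _ _) h with All.++⁻ a h
... | pa , py ∷ px ∷ pz ∷ pb = All.++⁺ pa (px ∷ py ∷ pz ∷ pb)
CKstep-All⁻ (br a b i) h with All.++⁻ a h
... | pa , psi ∷ pi ∷ _ ∷ pb = All.++⁺ pa (pi ∷ psi ∷ pi ∷ pb)

∼-All : ∀ {P : ℕ → Set} {ρ σ} → ρ ∼ σ → All P ρ → All P σ
∼-All ∼refl h = h
∼-All (∼fwd st p) h = ∼-All p (CKstep-All st h)
∼-All (∼bwd st p) h = ∼-All p (CKstep-All⁻ st h)

module _ {P : ℕ → Set} (f : ℕ → ℕ)
         (f-mono : ∀ {x y} → P x → P y → x < y → f x < f y)
         (f-suc : ∀ {i} → P i → f (suc i) ≡ suc (f i)) where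

  map-CKstep : ∀ {ρ σ} → CKstep ρ σ → All P ρ → CKstep (map f ρ) (map f σ)
  map-CKstep (ck1 a b x y z y<x x<z) h with All.++⁻ a h
  ... | _ , px ∷ py ∷ pz ∷ _
    rewrite List.map-++ f a (x ∷ y ∷ z ∷ b) | List.map-++ f a (x ∷ z ∷ y ∷ b)
    = ck1 (map f a) (map f b) (f x) (f y) (f z) (f-mono py px y<x) (f-mono px pz x<z)
  map-CKstep (ck2 a b x y z y<z z<x) h with All.++⁻ a h
  ... | _ , px ∷ py ∷ pz ∷ _
    rewrite List.map-++ f a (x ∷ y ∷ z ∷ b) | List.map-++ f a (y ∷ x ∷ z ∷ b)
    = ck2 (map f a) (map f b) (f x) (f y) (f z) (f-mono py pz y<z) (f-mono pz px z<x)
  map-CKstep (br a b i) h with All.++⁻ a h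
  ... | _ , pi ∷ _
    rewrite List.map-++ f a (i ∷ suc i ∷ i ∷ b) | List.map-++ f a (suc i ∷ i ∷ suc i ∷ b)
          | f-suc pi
    = br (map f a) (map f b) (f i)

  map-∼ : ∀ {ρ σ} → ρ ∼ σ → All P ρ → map f ρ ∼ map f σ
  map-∼ ∼refl h = ∼refl
  map-∼ (∼fwd st p) h = ∼fwd (map-CKstep st h) (map-∼ p (CKstep-All st h))
  map-∼ (∼bwd st p) h = ∼bwd (map-CKstep st (CKstep-All⁻ st h)) (map-∼ p (CKstep-All⁻ st h))

shiftWord : ℕ → Word → Word
shiftWord N = map (λ x → N + x)

unshiftWord : ℕ → Word → Word
unshiftWord N = map (_∸ N)

module _ (N : ℕ) where

  shiftWord-≥ : ∀ ρ → All (N ≤_) (shiftWord N ρ)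
  shiftWord-≥ ρ = All.map⁺ (All.universal (ℕP.m≤m+n N) ρ)

  unshift-shift : ∀ ρ → unshiftWord N (shiftWord N ρ) ≡ ρ
  unshift-shift ρ = trans (sym (List.map-∘ ρ)) (List.map-id-local (All.universal (ℕP.m+n∸m≡n N) ρ))

  shift-unshift : ∀ {τ} → All (N ≤_) τ → shiftWord N (unshiftWord N τ) ≡ τ
  shift-unshift {τ} τ≥N = trans (sym (List.map-∘ τ)) (List.map-id-local (All.map ℕP.m+[n∸m]≡n τ≥N))

  shiftWord-∼ : ∀ {ρ σ} → ρ ∼ σ → shiftWord N ρ ∼ shiftWord N σ
  shiftWord-∼ {ρ} ρ∼σ =
    map-∼ {P = λ _ → ⊤} (λ x → N + x) (λ _ _ → ℕP.+-monoʳ-< N) (λ {i} _ → ℕP.+-suc N i)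
          ρ∼σ (All.universal (λ _ → tt) ρ)

  unshiftWord-∼ : ∀ {ρ σ} → ρ ∼ σ → All (N ≤_) ρ → unshiftWord N ρ ∼ unshiftWord N σ
  unshiftWord-∼ =
    map-∼ (_∸ N) (λ N≤x _ x<y → ℕP.∸-monoˡ-< x<y N≤x) (λ N≤i → ℕP.+-∸-assoc 1 N≤i)

  shiftWord-∼⁻ : ∀ {ρ σ} → shiftWord N ρ ∼ shiftWord N σ → ρ ∼ σ
  shiftWord-∼⁻ {ρ} {σ} sρ∼sσ =
    subst₂ _∼_ (unshift-shift ρ) (unshift-shift σ) (unshiftWord-∼ sρ∼sσ (shiftWord-≥ ρ))

  ∼-shiftWord-image : ∀ {τ ρ} → τ ∼ shiftWord N ρ → Σ Word λ υ → τ ≡ shiftWord N υ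
  ∼-shiftWord-image {τ} {ρ} τ∼sρ =
    unshiftWord N τ , sym (shift-unshift (∼-All (∼-sym τ∼sρ) (shiftWord-≥ ρ)))

extendRuns : ℕ → List Word → List Word
extendRuns x [] = (x ∷ []) ∷ []
extendRuns x ([] ∷ rs) = (x ∷ []) ∷ rs
extendRuns x ((y ∷ r) ∷ rs) = if x <ᵇ y then (x ∷ y ∷ r) ∷ rs else (x ∷ []) ∷ (y ∷ r) ∷ rs

runs-∷ : ∀ x xs → runs (x ∷ xs) ≡ extendRuns x (runs xs)
runs-∷ x xs with runs xs
... | [] = refl
... | [] ∷ rs = refl
... | (y ∷ r) ∷ rs = refl

data NonEmpty : Word → Set where
  nonEmpty : ∀ {x xs} → NonEmpty (x ∷ xs)

extendRuns-nonEmpty : ∀ x rs → All NonEmpty rs → All NonEmpty (extendRuns x rs)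
extendRuns-nonEmpty x [] _ = nonEmpty ∷ []
extendRuns-nonEmpty x ((y ∷ r) ∷ rs) (ne ∷ nes) with x <ᵇ y
... | true = nonEmpty ∷ nes
... | false = nonEmpty ∷ ne ∷ nes

runs-nonEmpty : ∀ xs → All NonEmpty (runs xs)
runs-nonEmpty [] = []
runs-nonEmpty (x ∷ xs) rewrite runs-∷ x xs = extendRuns-nonEmpty x (runs xs) (runs-nonEmpty xs)

module _ (f : ℕ → ℕ) (f-<ᵇ : ∀ x y → (f x <ᵇ f y) ≡ (x <ᵇ y)) where

  extendRuns-map : ∀ x rs → extendRuns (f x) (map (map f) rs) ≡ map (map f) (extendRuns x rs)
  extendRuns-map x [] = refl
  extendRuns-map x ([] ∷ rs) = refl
  extendRuns-map x ((y ∷ r) ∷ rs) rewrite f-<ᵇ x y with x <ᵇ y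
  ... | true = refl
  ... | false = refl

  runs-map : ∀ xs → runs (map f xs) ≡ map (map f) (runs xs)
  runs-map [] = refl
  runs-map (x ∷ xs) = begin
    runs (f x ∷ map f xs)                      ≡⟨ runs-∷ (f x) (map f xs) ⟩
    extendRuns (f x) (runs (map f xs))         ≡⟨ cong (extendRuns (f x)) (runs-map xs) ⟩
    extendRuns (f x) (map (map f) (runs xs))   ≡⟨ extendRuns-map x (runs xs) ⟩
    map (map f) (extendRuns x (runs xs))       ≡⟨ cong (map (map f)) (runs-∷ x xs) ⟨
    map (map f) (runs (x ∷ xs))                ∎
    where open ≡-Reasoning

+-<ᵇ : ∀ N x y → (N + x <ᵇ N + y) ≡ (x <ᵇ y)
+-<ᵇ zero x y = refl
+-<ᵇ (suc N) x y = +-<ᵇ N x y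

nextRow : ℤ → ℤ → ℤ
nextRow a prev = if ⌊ a ℤ.<? prev ⌋ then a else prev ℤ.- + 1

nextRow-+ : ∀ a p n → nextRow (a ℤ.+ n) (p ℤ.+ n) ≡ nextRow a p ℤ.+ n
nextRow-+ a p n = begin
  (if ⌊ a ℤ.+ n ℤ.<? p ℤ.+ n ⌋ then a ℤ.+ n else p ℤ.+ n ℤ.- + 1)
    ≡⟨ cong₂ (λ b q → if b then a ℤ.+ n else q)
             (isYes-⇔ (+-cancelʳ-<-⇔ a p n) _ _) (xy∙z≈xz∙y p n (ℤ.- + 1)) ⟩
  (if ⌊ a ℤ.<? p ⌋ then a ℤ.+ n else p ℤ.- + 1 ℤ.+ n)
    ≡⟨ if-float (ℤ._+ n) ⌊ a ℤ.<? p ⌋ ⟨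
  nextRow a p ℤ.+ n
    ∎
  where open ≡-Reasoning

nth-map : ∀ (f : ℕ → ℕ) σ c → nth (map f σ) c ≡ Maybe.map f (nth σ c)
nth-map f [] c = refl
nth-map f (x ∷ σ) zero = refl
nth-map f (x ∷ σ) (suc c) = nth-map f σ c

module _ (N : ℕ) where

  shiftRow : ℤ × Word → ℤ × Word
  shiftRow (r , σ) = (r ℤ.+ + N , shiftWord N σ)

  placeAfter-shift : ∀ prev σs → All NonEmpty σs →
    placeAfter (prev ℤ.+ + N) (map (shiftWord N) σs) ≡ map shiftRow (placeAfter prev σs)
  placeAfter-shift prev [] [] = refl
  placeAfter-shift prev ((x ∷ σ) ∷ σs) (nonEmpty ∷ nes) = begin
    placeAfter (prev ℤ.+ + N) (map (shiftWord N) ((x ∷ σ) ∷ σs))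
      ≡⟨ cong (λ row → (row , shiftWord N (x ∷ σ)) ∷ placeAfter row (map (shiftWord N) σs))
              nextRow-shift ⟩
    (row ℤ.+ + N , shiftWord N (x ∷ σ)) ∷ placeAfter (row ℤ.+ + N) (map (shiftWord N) σs)
      ≡⟨ cong (_ ∷_) (placeAfter-shift row σs nes) ⟩
    map shiftRow (placeAfter prev ((x ∷ σ) ∷ σs))
      ∎
    where
    open ≡-Reasoning
    row : ℤ
    row = nextRow (+ x) prev
    nextRow-shift : nextRow (+ (N + x)) (prev ℤ.+ + N) ≡ row ℤ.+ + N
    nextRow-shift = trans (cong (λ a → nextRow a (prev ℤ.+ + N)) (+[m+n]≡+n++m N x))
                          (nextRow-+ (+ x) prev (+ N))

  place-shift : ∀ σs → All NonEmpty σs → place (map (shiftWord N) σs) ≡ map shiftRow (place σs)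
  place-shift [] [] = refl
  place-shift ((x ∷ σ) ∷ σs) (nonEmpty ∷ nes)
    rewrite +[m+n]≡+n++m N x = cong (_ ∷_) (placeAfter-shift (+ x) σs nes)

  wdtRows-shift : ∀ ρ → wdtRows (shiftWord N ρ) ≡ map shiftRow (wdtRows ρ)
  wdtRows-shift ρ rewrite runs-map (λ x → N + x) (+-<ᵇ N) ρ = place-shift (runs ρ) (runs-nonEmpty ρ)

  row-test-shift : ∀ r' r → ⌊ r' ℤ.+ + N ℤ.≟ r ⌋ ≡ ⌊ r' ℤ.≟ r ℤ.- + N ⌋
  row-test-shift r' r = isYes-⇔ (+≡⇔≡- r' r (+ N)) _ _

  lookupRows-shift : ∀ ps r c →
    lookupRows (map shiftRow ps) r c ≡ Maybe.map (λ x → N + x) (lookupRows ps (r ℤ.- + N) c)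
  lookupRows-shift [] r c = refl
  lookupRows-shift ((r' , σ) ∷ ps) r zero = refl
  lookupRows-shift ((r' , σ) ∷ ps) r (suc c) rewrite row-test-shift r' r with ⌊ r' ℤ.≟ r ℤ.- + N ⌋
  ... | true = nth-map (λ x → N + x) σ c
  ... | false = lookupRows-shift ps r (suc c)

  WeakDesTab-shift : ∀ σ r c → WeakDesTab (shiftWord N σ) r c ≡ shiftP N (WeakDesTab σ) r c
  WeakDesTab-shift σ r c rewrite wdtRows-shift σ = lookupRows-shift (wdtRows σ) r c

  rowLen-shift : ∀ ps r → rowLen (map shiftRow ps) r ≡ rowLen ps (r ℤ.- + N)
  rowLen-shift [] r = refl
  rowLen-shift ((r' , σ) ∷ ps) r rewrite row-test-shift r' r with ⌊ r' ℤ.≟ r ℤ.- + N ⌋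
  ... | true = List.length-map (λ x → N + x) σ
  ... | false = rowLen-shift ps r

  des-shift : ∀ ρ i → des (shiftWord N ρ) i ≡ rowLen (wdtRows ρ) (+ i ℤ.- + N)
  des-shift ρ i rewrite wdtRows-shift ρ = rowLen-shift (wdtRows ρ) (+ i)

  NonVirtual-shift : ∀ ρ → NonVirtual ρ → NonVirtual (shiftWord N ρ)
  NonVirtual-shift ρ nv rewrite wdtRows-shift ρ =
    All.map⁺ (All.map (λ 1≤r → ℤP.≤-trans 1≤r (ℤP.i≤i+j _ (+ N))) nv)

rowLen-below : ∀ ps {z} → All (λ p → + 1 ℤ.≤ proj₁ p) ps → z ℤ.< + 1 → rowLen ps z ≡ 0
rowLen-below [] _ _ = refl
rowLen-below ((r , σ) ∷ ps) {z} (1≤r ∷ hs) z<1 with r ℤ.≟ z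
... | yes refl = contradiction 1≤r (ℤP.<⇒≱ z<1)
... | no _ = rowLen-below ps hs z<1

rowLen-nonEmpty : ∀ ps {p} → All (λ p → NonEmpty (proj₂ p)) ps → p ∈ ps → 0 < rowLen ps (proj₁ p)
rowLen-nonEmpty ((r , σ) ∷ ps) (nonEmpty ∷ _) (here refl) with r ℤ.≟ r
... | yes _ = s≤s z≤n
... | no r≢r = contradiction refl r≢r
rowLen-nonEmpty ((r , σ) ∷ ps) {p} (nonEmpty ∷ nes) (there p∈) with ⌊ r ℤ.≟ proj₁ p ⌋
... | true = s≤s z≤n
... | false = rowLen-nonEmpty ps nes p∈

wdtRows-nonEmpty : ∀ ρ → All (λ p → NonEmpty (proj₂ p)) (wdtRows ρ)
wdtRows-nonEmpty ρ = place-nonEmpty (runs ρ) (runs-nonEmpty ρ)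
  where
  placeAfter-nonEmpty : ∀ prev σs → All NonEmpty σs → All (λ p → NonEmpty (proj₂ p)) (placeAfter prev σs)
  placeAfter-nonEmpty prev [] [] = []
  placeAfter-nonEmpty prev (σ ∷ σs) (ne ∷ nes) = ne ∷ placeAfter-nonEmpty _ σs nes
  place-nonEmpty : ∀ σs → All NonEmpty σs → All (λ p → NonEmpty (proj₂ p)) (place σs)
  place-nonEmpty [] [] = []
  place-nonEmpty (σ ∷ σs) (ne ∷ nes) = ne ∷ placeAfter-nonEmpty _ σs nes

psum-≗0 : ∀ μ k → (∀ i → 1 ≤ i → i ≤ k → μ i ≡ 0) → psum μ k ≡ 0
psum-≗0 μ zero _ = refl
psum-≗0 μ (suc k) μ≗0 =
  cong₂ _+_ (psum-≗0 μ k λ i 1≤i i≤k → μ≗0 i 1≤i (ℕP.m≤n⇒m≤1+n i≤k))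
            (μ≗0 (suc k) (s≤s z≤n) ℕP.≤-refl)

psum≡0⇒≗0 : ∀ μ k → psum μ k ≡ 0 → ∀ i → 1 ≤ i → i ≤ k → μ i ≡ 0
psum≡0⇒≗0 μ zero _ i 1≤i i≤0 = contradiction (ℕP.≤-trans 1≤i i≤0) λ ()
psum≡0⇒≗0 μ (suc k) sum≡0 i 1≤i i≤1+k with ℕP.m≤n⇒m<n∨m≡n i≤1+k
... | inj₁ (s≤s i≤k) = psum≡0⇒≗0 μ k (ℕP.m+n≡0⇒m≡0 _ sum≡0) i 1≤i i≤k
... | inj₂ refl = ℕP.m+n≡0⇒n≡0 (psum μ k) sum≡0

module _ (N : ℕ) where

  des-shift-+ : ∀ ρ i → des (shiftWord N ρ) (N + i) ≡ des ρ i
  des-shift-+ ρ i = trans (des-shift N ρ (N + i)) (cong (rowLen (wdtRows ρ)) (+[m+n]-+m≡+n N i))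

  des-shift-≤ : ∀ ρ → NonVirtual ρ → ∀ {i} → i ≤ N → des (shiftWord N ρ) i ≡ 0
  des-shift-≤ ρ nv {i} i≤N = trans (des-shift N ρ i) (rowLen-below (wdtRows ρ) nv i-N<1)
    where
    i-N<1 : + i ℤ.- + N ℤ.< + 1
    i-N<1 = ℤP.≤-<-trans (ℤP.i≤j⇒i-j≤0 (+≤+ i≤N)) (+<+ (s≤s z≤n))

  psum-des-shift-≤ : ∀ ρ → NonVirtual ρ → ∀ {k} → k ≤ N → psum (des (shiftWord N ρ)) k ≡ 0
  psum-des-shift-≤ ρ nv {k} k≤N = psum-≗0 _ k λ i _ i≤k → des-shift-≤ ρ nv (ℕP.≤-trans i≤k k≤N)

  psum-des-shift : ∀ ρ → NonVirtual ρ → ∀ m → psum (des (shiftWord N ρ)) (N + m) ≡ psum (des ρ) m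
  psum-des-shift ρ nv zero rewrite ℕP.+-identityʳ N = psum-des-shift-≤ ρ nv ℕP.≤-refl
  psum-des-shift ρ nv (suc m) rewrite ℕP.+-suc N m =
    cong₂ _+_ (psum-des-shift ρ nv m)
              (trans (cong (des (shiftWord N ρ)) (sym (ℕP.+-suc N m))) (des-shift-+ ρ (suc m)))

  ⊴-shift : ∀ ρ σ → NonVirtual ρ → NonVirtual σ → des ρ ⊴ des σ →
            des (shiftWord N ρ) ⊴ des (shiftWord N σ)
  ⊴-shift ρ σ nvρ nvσ ρ⊴σ k with k ≤? N
  ... | yes k≤N = ℕP.≤-trans (ℕP.≤-reflexive (psum-des-shift-≤ ρ nvρ k≤N)) z≤n
  ... | no k≰N = begin
    psum (des (shiftWord N ρ)) k         ≡⟨ cong (psum _) k≡N+m ⟩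
    psum (des (shiftWord N ρ)) (N + m)   ≡⟨ psum-des-shift ρ nvρ m ⟩
    psum (des ρ) m                       ≤⟨ ρ⊴σ m ⟩
    psum (des σ) m                       ≡⟨ psum-des-shift σ nvσ m ⟨
    psum (des (shiftWord N σ)) (N + m)   ≡⟨ cong (psum _) k≡N+m ⟨
    psum (des (shiftWord N σ)) k         ∎
    where
    open ℕP.≤-Reasoning
    m = k ∸ N
    k≡N+m : k ≡ N + m
    k≡N+m = sym (ℕP.m+[n∸m]≡n (ℕP.<⇒≤ (ℕP.≰⇒> k≰N)))

  ⊴-unshift : ∀ ρ σ → NonVirtual ρ → NonVirtual σ →
              des (shiftWord N ρ) ⊴ des (shiftWord N σ) → des ρ ⊴ des σ
  ⊴-unshift ρ σ nvρ nvσ sρ⊴sσ m = begin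
    psum (des ρ) m                       ≡⟨ psum-des-shift ρ nvρ m ⟨
    psum (des (shiftWord N ρ)) (N + m)   ≤⟨ sρ⊴sσ (N + m) ⟩
    psum (des (shiftWord N σ)) (N + m)   ≡⟨ psum-des-shift σ nvσ m ⟩
    psum (des σ) m                       ∎
    where open ℕP.≤-Reasoning

  NonVirtual-unshift : ∀ ρ → NonVirtual (shiftWord N ρ) →
    (∀ {i} → 1 ≤ i → i ≤ N → des (shiftWord N ρ) i ≡ 0) → NonVirtual ρ
  NonVirtual-unshift ρ nv-sρ low = All.tabulate row≥1
    where
    shifted-row≥1 : All (λ p → + 1 ℤ.≤ proj₁ p ℤ.+ + N) (wdtRows ρ)
    shifted-row≥1 = All.map⁻ (subst (All (λ p → + 1 ℤ.≤ proj₁ p)) (wdtRows-shift N ρ) nv-sρ)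
    row≥1 : ∀ {p} → p ∈ wdtRows ρ → + 1 ℤ.≤ proj₁ p
    row≥1 {p} p∈ = ℤP.≮⇒≥ λ r<1 →
      empty-row (1≤r+N∧r≤0⇒r≡i-N N (All.lookup shifted-row≥1 p∈) (ℤP.i<j⇒i≤pred[j] r<1))
      where
      empty-row : (Σ ℕ λ i → 1 ≤ i × i ≤ N × proj₁ p ≡ + i ℤ.- + N) → ⊥
      empty-row (i , 1≤i , i≤N , r≡i-N) = ℕP.n≮0 (begin-strict
        0                                     <⟨ rowLen-nonEmpty (wdtRows ρ) (wdtRows-nonEmpty ρ) p∈ ⟩
        rowLen (wdtRows ρ) (proj₁ p)          ≡⟨ cong (rowLen (wdtRows ρ)) r≡i-N ⟩
        rowLen (wdtRows ρ) (+ i ℤ.- + N)      ≡⟨ des-shift N ρ i ⟨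
        des (shiftWord N ρ) i                 ≡⟨ low 1≤i i≤N ⟩
        0                                     ∎)
        where open ℕP.≤-Reasoning

  ≼-shift : ∀ {ρ σ} → NonVirtual ρ → NonVirtual σ → ρ ≼ σ → shiftWord N ρ ≼ shiftWord N σ
  ≼-shift {ρ} {σ} nvρ nvσ (ρ∼σ , ρ⊴σ) = shiftWord-∼ N ρ∼σ , ⊴-shift ρ σ nvρ nvσ ρ⊴σ

  ≼-unshift : ∀ {ρ σ} → NonVirtual ρ → NonVirtual σ → shiftWord N ρ ≼ shiftWord N σ → ρ ≼ σ
  ≼-unshift {ρ} {σ} nvρ nvσ (sρ∼sσ , sρ⊴sσ) =
    shiftWord-∼⁻ N sρ∼sσ , ⊴-unshift ρ σ nvρ nvσ sρ⊴sσ

  IsYamanouchiOf-shift : ∀ {ρ σ} → IsYamanouchiOf ρ σ → IsYamanouchiOf (shiftWord N ρ) (shiftWord N σ)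
  IsYamanouchiOf-shift {ρ} {σ} (σ∼ρ , nvσ , σ-minimal) =
    shiftWord-∼ N σ∼ρ , NonVirtual-shift N σ nvσ , sσ-minimal
    where
    sσ-minimal : ∀ τ → τ ∼ shiftWord N ρ → NonVirtual τ → τ ≼ shiftWord N σ → shiftWord N σ ≼ τ
    sσ-minimal τ τ∼sρ nvτ τ≼sσ with ∼-shiftWord-image N τ∼sρ
    ... | υ , refl =
      ≼-shift nvσ nvυ (σ-minimal υ (shiftWord-∼⁻ N τ∼sρ) nvυ (≼-unshift nvυ nvσ τ≼sσ))
      where
      low-rows-empty : psum (des (shiftWord N υ)) N ≡ 0
      low-rows-empty = ℕP.n≤0⇒n≡0
        (ℕP.≤-trans (proj₂ τ≼sσ N) (ℕP.≤-reflexive (psum-des-shift-≤ σ nvσ ℕP.≤-refl)))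
      nvυ : NonVirtual υ
      nvυ = NonVirtual-unshift υ nvτ (psum≡0⇒≗0 _ N low-rows-empty _)

  IsPhat-shift : ∀ {ρ T} → IsPhat ρ T → IsPhat (shiftWord N ρ) (shiftP N T)
  IsPhat-shift (σ , σ-yam , T≗WDT) =
    shiftWord N σ , IsYamanouchiOf-shift σ-yam ,
    λ r c → trans (cong (Maybe.map (λ x → N + x)) (T≗WDT (r ℤ.- + N) c))
                  (sym (WeakDesTab-shift N σ r c))

just-map⇔just : ∀ {A B : Set} (f : A → B) (m : Maybe A) →
  (Σ B λ v → Maybe.map f m ≡ just v) ⇔ (Σ A λ v → m ≡ just v)
just-map⇔just f (just x) = mk⇔ (λ _ → x , refl) (λ _ → f x , refl)
just-map⇔just f nothing = mk⇔ (λ { (_ , ()) }) (λ { (_ , ()) })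

module _ (N : ℕ) where

  InDiag-shiftP : ∀ T r c → InDiag (shiftP N T) r c ⇔ InDiag T (r ℤ.- + N) c
  InDiag-shiftP T r c = just-map⇔just (λ x → N + x) (T (r ℤ.- + N) c)

  concat-take-shift : ∀ j rf → concat (take j (shift N rf)) ≡ shiftWord N (concat (take j rf))
  concat-take-shift j rf = trans (cong concat (List.take-map j rf)) (List.concat-map (take j rf))

  IsQhat-shift : ∀ rf {Q} → IsQhat rf Q → IsQhat (shift N rf) (shiftQ N Q)
  IsQhat-shift rf (Ts , Ts-P̂ , Q-diag , Q-entries) rewrite List.length-map (shiftWord N) rf =
    (λ j → shiftP N (Ts j)) ,
    (λ j j≤ → subst (λ ρ → IsPhat ρ (shiftP N (Ts j))) (sym (concat-take-shift j rf))
                    (IsPhat-shift N (Ts-P̂ j j≤))) ,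
    (λ r c → ⇔.trans (Q-diag (r ℤ.- + N) c) (⇔.sym (InDiag-shiftP (Ts (length rf)) r c))) ,
    λ r c i → ⇔.trans (Q-entries (r ℤ.- + N) c i)
      (⇔.refl ×-⇔ ⇔.refl ×-⇔ ⇔.sym (InDiag-shiftP (Ts (suc (length rf) ∸ i)) r c) ×-⇔
       ¬-cong-⇔ (⇔.sym (InDiag-shiftP (Ts (length rf ∸ i)) r c)))

lemma4p11 : (w : ℕ → ℕ) (φ : ℕ → ℕ) → IsFlag φ → (N : ℕ) → 1 ≤ N →
    (r : Factorization) → RFC w φ r →
    (∀ T → IsPhat (concat r) T → IsPhat (concat (shift N r)) (shiftP N T)) ×
    (∀ Q → IsQhat r Q → IsQhat (shift N r) (shiftQ N Q))
lemma4p11 _ _ _ N _ r _ = P̂-shift , λ Q → IsQhat-shift N r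
  where
  P̂-shift : ∀ T → IsPhat (concat r) T → IsPhat (concat (shift N r)) (shiftP N T)
  P̂-shift T = subst (λ ρ → IsPhat ρ (shiftP N T)) (sym (List.concat-map r)) ∘ IsPhat-shift N
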